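{- For every positive integer $m$, $g(2,m) = m+1$.
   Context: Fix positive integers $n,m$ and write $[m]=\{1,\ldots,m\}$. Let $\mathcal{F}=\{C_1,\ldots,C_k\}$ be a multiset of non-empty subsets of $[m]$ (repetitions allowed; the members are indexed by $[k]$). A resolution of $\mathcal{F}$ into $n$ classes is a partition $\{A_1,\ldots,A_n\}$ of the index set $[k]$ into $n$ blocks such that for each $i\in[n]$ the sets $C_j$, $j\in A_i$, are pairwise disjoint and their union is $[m]$. $\mathcal{F}$ is uniquely resolvable (with respect to $(n,m)$) if it has exactly one such resolution, where partitions of $[k]$ are regarded as unordered (two resolutions differing only by relabeling the blocks are the same). $g(n,m)$ denotes the maximum size $k$ of a uniquely resolvable multiset with respect to $(n,m)$. -}

module Defs where

open import Data.Nat using (ℕ; _≤_)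
open import Data.Fin using (Fin)
open import Data.Fin.Subset using (Subset; _∈_; Nonempty)
open import Data.Product using (Σ; ∃; _×_)
open import Relation.Binary.PropositionalEquality using (_≡_; _≢_)
open import Relation.Nullary using (¬_)
open import Function.Bundles using (_⇔_)

-- A multiset F = {C_1,…,C_k} of subsets of [m], indexed by [k] = Fin k.
Family : ℕ → ℕ → Set
Family k m = Fin k → Subset m

AllNonEmpty : ∀ {k m} → Family k m → Set
AllNonEmpty {k} C = (j : Fin k) → Nonempty (C j)

-- A partition of [k] into n (non-empty) blocks, given by a block-labelling
-- f : [k] → [n]; block A_i = f⁻¹(i).  Blocks are non-empty: f surjective.
IsResolution : ∀ {k m} (n : ℕ) → Family k m → (Fin k → Fin n) → Set
IsResolution {k} {m} n C f =
  ((i : Fin n) → ∃ λ j → f j ≡ i)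
  × ((i : Fin n) →
       ((j j′ : Fin k) → f j ≡ i → f j′ ≡ i → j ≢ j′ →
          (x : Fin m) → ¬ (x ∈ C j × x ∈ C j′))
     × ((x : Fin m) → ∃ λ j → f j ≡ i × x ∈ C j))

SamePartition : ∀ {k n} → (Fin k → Fin n) → (Fin k → Fin n) → Set
SamePartition {k} f f′ = (j j′ : Fin k) → (f j ≡ f j′) ⇔ (f′ j ≡ f′ j′)

UniquelyResolvable : ∀ {k m} (n : ℕ) → Family k m → Set
UniquelyResolvable {k} n C =
  Σ (Fin k → Fin n) λ f → IsResolution n C f
    × ((f′ : Fin k → Fin n) → IsResolution n C f′ → SamePartition f f′)

IsG : ℕ → ℕ → ℕ → Set
IsG n m K =
  (Σ (Family K m) λ C → AllNonEmpty C × UniquelyResolvable n C)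
  × ((k : ℕ) (C : Family k m) → AllNonEmpty C → UniquelyResolvable n C → k ≤ K)

{-# OPTIONS --safe #-}
module Submission where

-- Upper bound: in a resolution into two classes every point lies in exactly one member of
-- each class, so the points are the m edges of a multigraph on the k members.  If k ≥ m + 2
-- this graph is disconnected; swapping the two class labels on one of its edge-closed parts
-- gives a second resolution, so the family is not uniquely resolvable.
-- Lower bound: [m] together with its m singletons is uniquely resolvable, since every
-- resolution must separate [m] from each singleton.

open import Defs
open import Data.Bool using (Bool; true; false; if_then_else_)
open import Data.Empty using (⊥-elim)
open import Data.Fin using (Fin; zero; suc; punchIn; punchOut; _≟_)
open import Data.Fin.Permutation using (Permutation′; _⟨$⟩ʳ_; _⟨$⟩ˡ_; inverseʳ; inverseˡ; transpose)
open import Data.Fin.Properties using (punchOut-cong; punchOut-punchIn; punchInᵢ≢i)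
open import Data.Fin.Subset using (⊤; ⁅_⁆; _∈_)
open import Data.Fin.Subset.Properties using (∈⊤; x∈⁅x⁆; x∈⁅y⁆⇒x≡y)
open import Data.List using (List; []; _∷_; length; map; allFin)
open import Data.List.Properties using (length-map; length-tabulate)
open import Data.List.Relation.Unary.All using (All; []; _∷_; lookup)
open import Data.List.Relation.Unary.All.Properties using (map⁻)
open import Data.List.Membership.Propositional.Properties using (∈-allFin)
open import Data.Nat using (ℕ; suc; _+_; _≤_; _<_; s≤s)
open import Data.Nat.Properties using (<⇒≤; ≮⇒≥; +-comm)
open import Data.Product using (Σ; ∃; _×_; _,_; proj₁; proj₂)
open import Function using (_∘_)
open import Function.Bundles using (Equivalence; mk⇔)
open import Relation.Binary.PropositionalEquality
open import Relation.Nullary using (¬_; yes; no)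

private
  variable
    k m n : ℕ

Closed : (Fin k → Bool) → List (Fin k × Fin k) → Set
Closed S E = All (λ e → S (proj₁ e) ≡ S (proj₂ e)) E

record Cut (E : List (Fin k × Fin k)) : Set where
  field
    side    : Fin k → Bool
    closed  : Closed side E
    inside  : ∃ λ j → side j ≡ true
    outside : ∃ λ j → side j ≡ false

cut-pullback : {E : List (Fin k × Fin k)} {k′ : ℕ} (c : Fin k → Fin k′) (s : Fin k′ → Fin k) →
               (∀ y → c (s y) ≡ y) → Cut (map (λ e → c (proj₁ e) , c (proj₂ e)) E) → Cut E
cut-pullback c s cs cut = record
  { side    = side ∘ c
  ; closed  = map⁻ closed
  ; inside  = s (proj₁ inside) , trans (cong side (cs _)) (proj₂ inside)
  ; outside = s (proj₁ outside) , trans (cong side (cs _)) (proj₂ outside)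
  }
  where open Cut cut

cut-∷ : {E : List (Fin k × Fin k)} {a b : Fin k} (cut : Cut E) →
        Cut.side cut a ≡ Cut.side cut b → Cut ((a , b) ∷ E)
cut-∷ cut sa≡sb = record
  { side = side ; closed = sa≡sb ∷ closed ; inside = inside ; outside = outside }
  where open Cut cut

-- Contract the edge a–b: b is sent where a goes, and the other vertices are renumbered.
contract : {a b : Fin (suc k)} → a ≢ b → Fin (suc k) → Fin k
contract {b = b} a≢b j with j ≟ b
... | yes _   = punchOut (a≢b ∘ sym)
... | no j≢b = punchOut (j≢b ∘ sym)

contract-identifies : {a b : Fin (suc k)} (a≢b : a ≢ b) → contract a≢b a ≡ contract a≢b b
contract-identifies {a = a} {b} a≢b with a ≟ b | b ≟ b
... | yes a≡b | _      = ⊥-elim (a≢b a≡b)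
... | no _    | yes _  = punchOut-cong b refl
... | no _    | no b≢b = ⊥-elim (b≢b refl)

contract-punchIn : {a b : Fin (suc k)} (a≢b : a ≢ b) (y : Fin k) → contract a≢b (punchIn b y) ≡ y
contract-punchIn {b = b} a≢b y with punchIn b y ≟ b
... | yes eq = ⊥-elim (punchInᵢ≢i b y eq)
... | no _   = trans (punchOut-cong b refl) (punchOut-punchIn b)

few-edges⇒cut : (E : List (Fin k × Fin k)) → length E + 1 < k → Cut E
few-edges⇒cut {suc (suc k)} [] _ = record
  { side    = λ { zero → true ; (suc _) → false }
  ; closed  = []
  ; inside  = zero , refl
  ; outside = suc zero , refl
  }
few-edges⇒cut {1} [] (s≤s ())
few-edges⇒cut ((a , b) ∷ E) E+1<k with a ≟ b
few-edges⇒cut ((a , a) ∷ E) E+1<k | yes refl = cut-∷ (few-edges⇒cut E (<⇒≤ E+1<k)) refl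
few-edges⇒cut {suc k} ((a , b) ∷ E) (s≤s E+1<k) | no a≢b =
  cut-∷ (cut-pullback (contract a≢b) (punchIn b) (contract-punchIn a≢b) contracted)
        (cong (Cut.side contracted) (contract-identifies a≢b))
  where
    contracted = few-edges⇒cut _ (subst (λ l → l + 1 < k) (sym (length-map _ E)) E+1<k)

module _ {C : Family k m} {f : Fin k → Fin n} (R : IsResolution n C f) where

  member : Fin n → Fin m → Fin k
  member i x = proj₁ (proj₂ (proj₂ R i) x)

  member-class : ∀ i x → f (member i x) ≡ i
  member-class i x = proj₁ (proj₂ (proj₂ (proj₂ R i) x))

  ∈-member : ∀ i x → x ∈ C (member i x)
  ∈-member i x = proj₂ (proj₂ (proj₂ (proj₂ R i) x))

  member-unique : ∀ {j x} → x ∈ C j → j ≡ member (f j) x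
  member-unique {j} {x} x∈j with j ≟ member (f j) x
  ... | yes eq  = eq
  ... | no j≢ = ⊥-elim (proj₁ (proj₂ R (f j)) j _ refl (member-class (f j) x) j≢ x (x∈j , ∈-member (f j) x))

covers⇒surjective : {C : Family k m} {f : Fin k → Fin n} → Fin m →
                    (∀ i x → ∃ λ j → f j ≡ i × x ∈ C j) → ∀ i → ∃ λ j → f j ≡ i
covers⇒surjective x₀ cover i = let (j , fj≡i , _) = cover i x₀ in j , fj≡i

Compatible : Family k m → (Fin k → Bool) → Set
Compatible {k} C S = ∀ (j j′ : Fin k) {x} → x ∈ C j → x ∈ C j′ → S j ≡ S j′

relabel : Permutation′ n → (Fin k → Bool) → (Fin k → Fin n) → Fin k → Fin n
relabel π S f j = if S j then π ⟨$⟩ʳ f j else f j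

module _ (π : Permutation′ n) (S : Fin k → Bool) (f : Fin k → Fin n) where

  relabel-inside : ∀ {j} → S j ≡ true → relabel π S f j ≡ π ⟨$⟩ʳ f j
  relabel-inside {j} Sj rewrite Sj = refl

  relabel-outside : ∀ {j} → S j ≡ false → relabel π S f j ≡ f j
  relabel-outside {j} Sj rewrite Sj = refl

  relabel-cancel : ∀ j j′ → S j ≡ S j′ → relabel π S f j ≡ relabel π S f j′ → f j ≡ f j′
  relabel-cancel j j′ Sj≡Sj′ eq with S j | S j′
  ... | true  | true  = trans (sym (inverseˡ π)) (trans (cong (π ⟨$⟩ˡ_) eq) (inverseˡ π))
  ... | false | false = eq

relabel-resolution : {C : Family k m} {f : Fin k → Fin n} (π : Permutation′ n) {S : Fin k → Bool} →
                     IsResolution n C f → Fin m → Compatible C S → IsResolution n C (relabel π S f)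
relabel-resolution {C = C} {f} π {S} R x₀ compatible =
  covers⇒surjective x₀ cover , λ i → disjoint , cover i
  where
    f′ = relabel π S f

    disjoint : ∀ {i} j j′ → f′ j ≡ i → f′ j′ ≡ i → j ≢ j′ → ∀ x → ¬ (x ∈ C j × x ∈ C j′)
    disjoint j j′ f′j≡i f′j′≡i j≢j′ x (x∈j , x∈j′) =
      proj₁ (proj₂ R (f j)) j j′ refl
        (sym (relabel-cancel π S f j j′ (compatible j j′ x∈j x∈j′) (trans f′j≡i (sym f′j′≡i))))
        j≢j′ x (x∈j , x∈j′)

    cover : ∀ i x → ∃ λ j → f′ j ≡ i × x ∈ C j
    cover i x with S (member R i x) in Sj
    ... | false = member R i x ,
                  trans (relabel-outside π S f Sj) (member-class R i x) , ∈-member R i x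
    ... | true  = j , f′j≡i , ∈-member R _ x
      where
        j = member R (π ⟨$⟩ˡ i) x
        Sj′ : S j ≡ true
        Sj′ = trans (compatible j (member R i x) (∈-member R _ x) (∈-member R i x)) Sj

        f′j≡i : f′ j ≡ i
        f′j≡i = begin
          f′ j                         ≡⟨ relabel-inside π S f Sj′ ⟩
          π ⟨$⟩ʳ f j                    ≡⟨ cong (π ⟨$⟩ʳ_) (member-class R _ x) ⟩
          π ⟨$⟩ʳ (π ⟨$⟩ˡ i)              ≡⟨ inverseʳ π ⟩
          i                            ∎
          where open ≡-Reasoning

swap : Permutation′ 2
swap = transpose zero (suc zero)

swap-fixes-nothing : ∀ i → swap ⟨$⟩ʳ i ≢ i
swap-fixes-nothing zero       ()
swap-fixes-nothing (suc zero) ()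

swap-other : ∀ {a b} → a ≢ b → swap ⟨$⟩ʳ a ≡ b
swap-other {zero}     {zero}     a≢b = ⊥-elim (a≢b refl)
swap-other {zero}     {suc zero} _   = refl
swap-other {suc zero} {zero}     _   = refl
swap-other {suc zero} {suc zero} a≢b = ⊥-elim (a≢b refl)

Fin2-≢⇒≡ : ∀ {a b c : Fin 2} → a ≢ c → b ≢ c → a ≡ b
Fin2-≢⇒≡ a≢c b≢c = trans (sym (swap-other (a≢c ∘ sym))) (swap-other (b≢c ∘ sym))

relabel-changes-partition : {S : Fin k → Bool} {f : Fin k → Fin 2} {j j′ : Fin k} →
                            S j ≡ true → S j′ ≡ false → ¬ SamePartition f (relabel swap S f)
relabel-changes-partition {S = S} {f} {j} {j′} Sj Sj′ same with f j ≟ f j′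
... | yes fj≡fj′ = swap-fixes-nothing (f j) (begin
  swap ⟨$⟩ʳ f j          ≡⟨ relabel-inside swap S f Sj ⟨
  relabel swap S f j    ≡⟨ Equivalence.to (same j j′) fj≡fj′ ⟩
  relabel swap S f j′   ≡⟨ relabel-outside swap S f Sj′ ⟩
  f j′                  ≡⟨ fj≡fj′ ⟨
  f j                   ∎)
  where open ≡-Reasoning
... | no fj≢fj′ = fj≢fj′ (Equivalence.from (same j j′)
  (trans (relabel-inside swap S f Sj)
  (trans (swap-other fj≢fj′) (sym (relabel-outside swap S f Sj′)))))

module _ {C : Family k m} {f : Fin k → Fin 2} (R : IsResolution 2 C f) where

  incidence : List (Fin k × Fin k)
  incidence = map (λ x → member R zero x , member R (suc zero) x) (allFin m)

  length-incidence : length incidence ≡ m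
  length-incidence = trans (length-map _ (allFin m)) (length-tabulate _)

  closed⇒compatible : {S : Fin k → Bool} → Closed S incidence → Compatible C S
  closed⇒compatible {S} closed j j′ {x} x∈j x∈j′ =
    trans (side-of-point x∈j) (sym (side-of-point x∈j′))
    where
      side-of-point : ∀ {j} → x ∈ C j → S j ≡ S (member R zero x)
      side-of-point {j} x∈j with f j | member-unique R x∈j
      ... | zero     | refl = refl
      ... | suc zero | refl = sym (lookup (map⁻ closed) (∈-allFin x))

uniquelyResolvable⇒≤ : {C : Family k m} → AllNonEmpty C → UniquelyResolvable 2 C → k ≤ m + 1
uniquelyResolvable⇒≤ {k} {m} nonEmpty (f , R , unique) = ≮⇒≥ λ m+1<k →
  let open Cut (few-edges⇒cut (incidence R) (subst (λ l → l + 1 < k) (sym (length-incidence R)) m+1<k))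
      x₀ = proj₁ (nonEmpty (proj₁ inside))
  in relabel-changes-partition (proj₂ inside) (proj₂ outside)
       (unique _ (relabel-resolution swap R x₀ (closed⇒compatible R closed)))

fullAndSingletons : Family (suc m) m
fullAndSingletons zero    = ⊤
fullAndSingletons (suc x) = ⁅ x ⁆

fullAndSingletons-nonEmpty : AllNonEmpty (fullAndSingletons {suc m})
fullAndSingletons-nonEmpty zero    = zero , ∈⊤
fullAndSingletons-nonEmpty (suc x) = x , x∈⁅x⁆ x

module _ {m : ℕ} where
  private C = fullAndSingletons {suc m}

  resolution-separates : ∀ {f} → IsResolution 2 C f → ∀ x → f (suc x) ≢ f zero
  resolution-separates R x eq = proj₁ (proj₂ R _) (suc x) zero eq refl (λ ()) x (x∈⁅x⁆ x , ∈⊤)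

  fullAndSingletons-uniquelyResolvable : UniquelyResolvable 2 C
  fullAndSingletons-uniquelyResolvable = f , R , same
    where
      f : Fin (suc (suc m)) → Fin 2
      f zero    = zero
      f (suc _) = suc zero

      disjoint : ∀ i j j′ → f j ≡ i → f j′ ≡ i → j ≢ j′ → ∀ x → ¬ (x ∈ C j × x ∈ C j′)
      disjoint _ zero    zero     _ _ j≢j′ _ _         = j≢j′ refl
      disjoint _ (suc y) (suc y′) _ _ j≢j′ x (x∈y , x∈y′) =
        j≢j′ (cong suc (trans (sym (x∈⁅y⁆⇒x≡y y x∈y)) (x∈⁅y⁆⇒x≡y y′ x∈y′)))
      disjoint _ zero    (suc _)  refl ()
      disjoint _ (suc _) zero     refl ()

      cover : ∀ i x → ∃ λ j → f j ≡ i × x ∈ C j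
      cover zero       x = zero , refl , ∈⊤
      cover (suc zero) x = suc x , refl , x∈⁅x⁆ x

      R : IsResolution 2 C f
      R = covers⇒surjective zero cover , λ i → disjoint i , cover i

      same : ∀ f′ → IsResolution 2 C f′ → SamePartition f f′
      same f′ R′ zero    zero     = mk⇔ (λ _ → refl) (λ _ → refl)
      same f′ R′ zero    (suc y)  = mk⇔ (λ ()) (⊥-elim ∘ resolution-separates R′ y ∘ sym)
      same f′ R′ (suc y) zero     = mk⇔ (λ ()) (⊥-elim ∘ resolution-separates R′ y)
      same f′ R′ (suc y) (suc y′) =
        mk⇔ (λ _ → Fin2-≢⇒≡ (resolution-separates R′ y) (resolution-separates R′ y′)) (λ _ → refl)

theorem12 : (m : ℕ) → 1 ≤ m → IsG 2 m (m + 1)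
theorem12 (suc m) _ =
  subst (λ K → Σ (Family K (suc m)) λ C → AllNonEmpty C × UniquelyResolvable 2 C) (+-comm 1 (suc m))
        (fullAndSingletons , fullAndSingletons-nonEmpty , fullAndSingletons-uniquelyResolvable) ,
  λ _ _ → uniquelyResolvable⇒≤
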